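{- Let $(\lambda,\mu)\in{\sf Kostka}_r^{\mathbb Z}$. Each column of $A^*(\lambda,\mu)$ is one of the following: (1) all $0$'s except for a single $1$; (2) all $0$'s except for a single $-1$ and a single $1$ below it; or (3) all $0$'s except for a single $-1$, a single $1$ above it and a single $1$ below it. Moreover, the leftmost column is of type (1), and the bottom row of $A^*(\lambda,\mu)$ contains no $-1$.
   Context: ${\sf Kostka}_r^{\mathbb Z}$ is the set of pairs $(\lambda,\mu)$ of partitions with at most $r$ nonzero parts, $|\lambda|=|\mu|$, $\sum_{i\le t}\lambda_i\ge\sum_{i\le t}\mu_i$ for all $t$. $\lambda'$ is the conjugate partition. Canonical (Ryser) matrix $A(\lambda,\mu)$: let $s=\lambda_1$. Start with the $r\times s$ $\{0,1\}$-matrix whose row $i$ has $\mu_i$ ones in columns $1,\ldots,\mu_i$. For $j=s,s-1,\ldots,1$ in turn: looking only at columns $1,\ldots,j$ of the current matrix, choose $\lambda'_j$ rows, taking rows with the largest number of $1$'s in columns $1,\ldots,j$ and breaking ties by preferring rows further south; in each chosen row, move the rightmost $1$ among columns $1,\ldots,j$ to column $j$. The final matrix is $A(\lambda,\mu)$. Define the $r\times s$ matrix $A^*(\lambda,\mu)_{i,j}=A(\lambda,\mu)_{i,j}-A(\lambda,\mu)_{i+1,j}$, where $A(\lambda,\mu)_{r+1,j}:=0$. -}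

module Defs where

open import Data.Nat using (ℕ; zero; suc; _+_; _≤_; _<_; _≤ᵇ_; _<ᵇ_; _≡ᵇ_)
open import Data.Bool using (Bool; true; false; if_then_else_; _∧_; _∨_)
open import Data.Maybe using (Maybe; just; nothing)
open import Data.Vec using (Vec; []; _∷_; lookup)
open import Data.Fin using (Fin; toℕ)
open import Data.Integer as ℤ using (ℤ; +_; -[1+_])
open import Data.Product using (Σ; ∃; ∃-syntax; _×_; _,_)
open import Data.Sum using (_⊎_)
open import Relation.Binary.PropositionalEquality using (_≡_; _≢_)

-- Partitions with at most r parts, as length-r vectors (padded by 0's)

-- entry i (0-based) of a length-r vector, 0 outside the range
at : ∀ {r} → Vec ℕ r → ℕ → ℕ
at []       _       = 0
at (x ∷ v)  zero    = x
at (x ∷ v)  (suc i) = at v i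

psum : ∀ {r} → Vec ℕ r → ℕ → ℕ
psum v zero    = 0
psum v (suc t) = psum v t + at v t

IsPartition : ∀ {r} → Vec ℕ r → Set
IsPartition {r} v = ∀ (i j : Fin r) → toℕ i ≤ toℕ j → lookup v j ≤ lookup v i

Kostka : (r : ℕ) → Vec ℕ r → Vec ℕ r → Set
Kostka r lam mu =
  IsPartition lam × IsPartition mu × psum lam r ≡ psum mu r ×
  (∀ t → t ≤ r → psum mu t ≤ psum lam t)

-- conjugate partition: λ'_j = #{ i : λ_i ≥ j }   (j is 1-based)
conj : ∀ {r} → Vec ℕ r → ℕ → ℕ
conj []      j = 0
conj (x ∷ v) j = (if j ≤ᵇ x then 1 else 0) + conj v j

-- λ₁ (0 if r = 0)
firstPart : ∀ {r} → Vec ℕ r → ℕ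
firstPart v = at v 0

-- Ryser's algorithm.  Matrices are ℕ → ℕ → Bool (row, column), 0-based.

BMat : Set
BMat = ℕ → ℕ → Bool

b2n : Bool → ℕ
b2n true  = 1
b2n false = 0

countRow : (ℕ → Bool) → ℕ → ℕ
countRow f zero    = 0
countRow f (suc j) = countRow f j + b2n (f j)

rightmost : (ℕ → Bool) → ℕ → Maybe ℕ
rightmost f zero    = nothing
rightmost f (suc j) = if f j then just j else rightmost f j

prefers : BMat → ℕ → ℕ → ℕ → Bool
prefers M j i' i =
  (countRow (M i) j <ᵇ countRow (M i') j) ∨
  ((countRow (M i) j ≡ᵇ countRow (M i') j) ∧ (i <ᵇ i'))

rank : BMat → ℕ → ℕ → ℕ → ℕ
rank M j zero     i = 0
rank M j (suc n)  i = rank M j n i + b2n (prefers M j n i)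

chosen : ℕ → BMat → ℕ → ℕ → ℕ → Bool
chosen r M j k i = (i <ᵇ r) ∧ (rank M j r i <ᵇ k)

moveRow : (ℕ → Bool) → ℕ → ℕ → Bool
moveRow f k c with rightmost f (suc k)
... | nothing = f c
... | just p  = if c ≡ᵇ k then true else (if c ≡ᵇ p then false else f c)

-- the step for (1-based) column j = suc k, choosing `cnt` rows
step : ℕ → ℕ → BMat → ℕ → BMat
step r cnt M k i = if chosen r M (suc k) cnt i then moveRow (M i) k else M i

run : ∀ {r} → Vec ℕ r → ℕ → BMat → BMat
run lam zero    M = M
run {r} lam (suc k) M = run lam k (step r (conj lam (suc k)) M k)

initMat : ∀ {r} → Vec ℕ r → BMat
initMat mu i c = c <ᵇ at mu i

Aℕ : ∀ {r} → Vec ℕ r → Vec ℕ r → ℕ → ℕ → ℕ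
Aℕ {r} lam mu i c =
  if (i <ᵇ r) ∧ (c <ᵇ firstPart lam)
  then b2n (run lam (firstPart lam) (initMat mu) i c)
  else 0

A : ∀ {r} → (lam mu : Vec ℕ r) → Fin r → Fin (firstPart lam) → ℤ
A lam mu i j = + Aℕ lam mu (toℕ i) (toℕ j)

-- A*(λ,μ)_{i,j} = A_{i,j} - A_{i+1,j}, with A_{r+1,j} = 0
Astar : ∀ {r} → (lam mu : Vec ℕ r) → Fin r → Fin (firstPart lam) → ℤ
Astar lam mu i j =
  (+ Aℕ lam mu (toℕ i) (toℕ j)) ℤ.- (+ Aℕ lam mu (suc (toℕ i)) (toℕ j))

-- Column types (row index increases southwards)

-1ℤ : ℤ
-1ℤ = -[1+ 0 ]

Type1 : ∀ {r} → (Fin r → ℤ) → Set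
Type1 c = ∃[ a ] (c a ≡ + 1 × (∀ k → k ≢ a → c k ≡ + 0))

Type2 : ∀ {r} → (Fin r → ℤ) → Set
Type2 c = ∃[ a ] ∃[ b ] (toℕ a < toℕ b × c a ≡ -1ℤ × c b ≡ + 1 ×
  (∀ k → k ≢ a → k ≢ b → c k ≡ + 0))

Type3 : ∀ {r} → (Fin r → ℤ) → Set
Type3 c = ∃[ b ] ∃[ a ] ∃[ d ] (toℕ b < toℕ a × toℕ a < toℕ d ×
  c a ≡ -1ℤ × c b ≡ + 1 × c d ≡ + 1 ×
  (∀ k → k ≢ a → k ≢ b → k ≢ d → c k ≡ + 0))

module Submission where

-- Ryser's algorithm fills the columns from right to left.  Before column k is filled, columns
-- 1 … k hold left-justified rows of weakly decreasing lengths h, and the diagram of h is dominated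
-- by λ cut down to k columns; in conjugate terms, Σᵢ (hᵢ ∸ m) ≤ Σᵢ (min(λᵢ, k) ∸ m) for all m,
-- with equality at m = 0.  This invariant forces at least λ'_k nonempty rows and at most λ'_k full
-- rows, so the λ'_k chosen rows are nonempty, every full row is chosen, and the invariant passes to
-- column k − 1.  With v the length of the λ'_k-th longest row, the chosen rows are those longer than
-- v together with the southernmost rows of length v: two blocks [0, α) ∪ [y, β) of row indices.  So
-- each column of A is the indicator of two blocks, and its downward differences are of type (1) if
-- its 1's form an initial segment, of type (2) if they form one later segment, and of type (3)
-- otherwise.  When the leftmost column is filled every row has length 0 or 1, so α = y = 0 and
-- the 1's form an initial segment.  Finally the bottom row of A* is a row of A, hence nonnegative.

open import Defs
open import Algebra.Properties.CommutativeSemigroup using (interchange)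
open import Data.Bool using (Bool; true; false; _∧_; _∨_; if_then_else_)
open import Data.Bool.Properties using (∨-identityʳ; ∧-identityʳ)
open import Data.Empty using (⊥-elim)
open import Data.Fin as Fin using (Fin; toℕ; fromℕ<)
open import Data.Fin.Properties using (toℕ-fromℕ<; toℕ-injective; toℕ<n)
open import Data.Integer as ℤ using (ℤ)
open import Data.Maybe using (just; nothing)
open import Data.Maybe.Properties using (just-injective)
open import Data.Nat using (ℕ; zero; suc; _+_; _*_; _∸_; _⊓_; _≤_; _<_; z≤n; s≤s; s≤s⁻¹; _<ᵇ_; _≤ᵇ_; _≡ᵇ_)
open import Data.Nat.Properties
open import Data.Product using (∃-syntax; _×_; _,_; proj₁; proj₂)
open import Data.Sum using (_⊎_; inj₁; inj₂; [_,_])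
open import Data.Vec using (Vec; []; _∷_; lookup)
open import Function using (_∘_; case_of_)
open import Relation.Binary.Definitions using (tri<; tri≈; tri>)
open import Relation.Binary.PropositionalEquality hiding ([_])
open import Relation.Nullary using (¬_; yes; no)
open import Relation.Nullary.Reflects using (Reflects; ofʸ; ofⁿ; det; fromEquivalence; _⊎-reflects_; _×-reflects_)

reflects⇒≡true : ∀ {A : Set} {b} → Reflects A b → A → b ≡ true
reflects⇒≡true r a = det r (ofʸ a)

reflects⇒≡false : ∀ {A : Set} {b} → Reflects A b → ¬ A → b ≡ false
reflects⇒≡false r ¬a = det r (ofⁿ ¬a)

≡true⇒reflected : ∀ {A : Set} {b} → Reflects A b → b ≡ true → A
≡true⇒reflected (ofʸ a) _ = a

≡false⇒reflected : ∀ {A : Set} {b} → Reflects A b → b ≡ false → ¬ A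
≡false⇒reflected (ofⁿ ¬a) _ = ¬a

≡ᵇ-reflects-≡ : ∀ m n → Reflects (m ≡ n) (m ≡ᵇ n)
≡ᵇ-reflects-≡ m n = fromEquivalence (≡ᵇ⇒≡ m n) (≡⇒≡ᵇ m n)

module _ {m n : ℕ} where

  <⇒<ᵇ≡true : m < n → (m <ᵇ n) ≡ true
  <⇒<ᵇ≡true = reflects⇒≡true (<ᵇ-reflects-< m n)

  ≥⇒<ᵇ≡false : n ≤ m → (m <ᵇ n) ≡ false
  ≥⇒<ᵇ≡false n≤m = reflects⇒≡false (<ᵇ-reflects-< m n) (≤⇒≯ n≤m)

  <ᵇ≡true⇒< : (m <ᵇ n) ≡ true → m < n
  <ᵇ≡true⇒< = ≡true⇒reflected (<ᵇ-reflects-< m n)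

  <ᵇ≡false⇒≥ : (m <ᵇ n) ≡ false → n ≤ m
  <ᵇ≡false⇒≥ e = ≮⇒≥ (≡false⇒reflected (<ᵇ-reflects-< m n) e)

  ≤⇒≤ᵇ≡true : m ≤ n → (m ≤ᵇ n) ≡ true
  ≤⇒≤ᵇ≡true = reflects⇒≡true (≤ᵇ-reflects-≤ m n)

  >⇒≤ᵇ≡false : n < m → (m ≤ᵇ n) ≡ false
  >⇒≤ᵇ≡false n<m = reflects⇒≡false (≤ᵇ-reflects-≤ m n) (<⇒≱ n<m)

  ≤ᵇ≡true⇒≤ : (m ≤ᵇ n) ≡ true → m ≤ n
  ≤ᵇ≡true⇒≤ = ≡true⇒reflected (≤ᵇ-reflects-≤ m n)

  ≤ᵇ≡false⇒> : (m ≤ᵇ n) ≡ false → n < m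
  ≤ᵇ≡false⇒> e = ≰⇒> (≡false⇒reflected (≤ᵇ-reflects-≤ m n) e)

  ≡⇒≡ᵇ≡true : m ≡ n → (m ≡ᵇ n) ≡ true
  ≡⇒≡ᵇ≡true = reflects⇒≡true (≡ᵇ-reflects-≡ m n)

  ≢⇒≡ᵇ≡false : m ≢ n → (m ≡ᵇ n) ≡ false
  ≢⇒≡ᵇ≡false = reflects⇒≡false (≡ᵇ-reflects-≡ m n)

+-<ᵇ-cancelˡ : ∀ a {x y} → (a + x <ᵇ a + y) ≡ (x <ᵇ y)
+-<ᵇ-cancelˡ zero    = refl
+-<ᵇ-cancelˡ (suc a) = +-<ᵇ-cancelˡ a

∸-suc-<ᵇ : ∀ {b d i} → i < b → (b ∸ suc i <ᵇ d) ≡ (b ∸ d ≤ᵇ i)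
∸-suc-<ᵇ {b} {d} {i} i<b with b ∸ d ≤? i
... | yes b∸d≤i = trans (<⇒<ᵇ≡true lt) (sym (≤⇒≤ᵇ≡true b∸d≤i))
  where
  lt : b ∸ suc i < d
  lt = subst (_≤ d) (+-∸-assoc 1 i<b)
         (m≤n+o⇒m∸n≤o b i (≤-trans (m≤n+m∸n b d) (≤-trans (+-monoʳ-≤ d b∸d≤i) (≤-reflexive (+-comm d i)))))
... | no  b∸d≰i = trans (≥⇒<ᵇ≡false ge) (sym (>⇒≤ᵇ≡false (≰⇒> b∸d≰i)))
  where
  i<b∸d = ≰⇒> b∸d≰i
  d≤b : d ≤ b
  d≤b = ≮⇒≥ (λ b<d → <⇒≱ i<b∸d (≤-trans (≤-reflexive (m≤n⇒m∸n≡0 (<⇒≤ b<d))) z≤n))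
  ge : d ≤ b ∸ suc i
  ge = m+n≤o⇒m≤o∸n d (subst (_≤ b) (+-comm (suc i) d) (≤-trans (+-monoˡ-≤ d i<b∸d) (≤-reflexive (m∸n+n≡m d≤b))))

sum< : (ℕ → ℕ) → ℕ → ℕ
sum< f zero    = 0
sum< f (suc n) = sum< f n + f n

count< : (ℕ → Bool) → ℕ → ℕ
count< P = sum< (λ i → b2n (P i))

sum<-cong : ∀ {f g} n → (∀ i → i < n → f i ≡ g i) → sum< f n ≡ sum< g n
sum<-cong zero    _  = refl
sum<-cong (suc n) eq = cong₂ _+_ (sum<-cong n (λ i i<n → eq i (m≤n⇒m≤1+n i<n))) (eq n ≤-refl)

sum<-mono-≤ : ∀ {f g} n → (∀ i → i < n → f i ≤ g i) → sum< f n ≤ sum< g n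
sum<-mono-≤ zero    _  = z≤n
sum<-mono-≤ (suc n) le = +-mono-≤ (sum<-mono-≤ n (λ i i<n → le i (m≤n⇒m≤1+n i<n))) (le n ≤-refl)

sum<-+ : ∀ f g n → sum< (λ i → f i + g i) n ≡ sum< f n + sum< g n
sum<-+ f g zero    = refl
sum<-+ f g (suc n) = trans (cong (_+ (f n + g n)) (sum<-+ f g n))
                           (interchange +-commutativeSemigroup (sum< f n) (sum< g n) (f n) (g n))

sum<-const : ∀ m n → sum< (λ _ → m) n ≡ n * m
sum<-const m zero    = refl
sum<-const m (suc n) = trans (cong (_+ m) (sum<-const m n)) (+-comm (n * m) m)

sum<-zero : ∀ f n → (∀ i → i < n → f i ≡ 0) → sum< f n ≡ 0
sum<-zero f zero    _  = refl
sum<-zero f (suc n) eq = cong₂ _+_ (sum<-zero f n (λ i i<n → eq i (m≤n⇒m≤1+n i<n))) (eq n ≤-refl)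

sum<-monoʳ-≤ : ∀ f {t n} → t ≤ n → sum< f t ≤ sum< f n
sum<-monoʳ-≤ f {t} {zero}  z≤n = z≤n
sum<-monoʳ-≤ f {t} {suc n} t≤1+n with m≤n⇒m<n∨m≡n t≤1+n
... | inj₁ t<1+n = ≤-trans (sum<-monoʳ-≤ f (s≤s⁻¹ t<1+n)) (m≤m+n (sum< f n) (f n))
... | inj₂ refl  = ≤-refl

sum<-vanishing-tail : ∀ f {t n} → t ≤ n → (∀ i → t ≤ i → i < n → f i ≡ 0) → sum< f n ≡ sum< f t
sum<-vanishing-tail f {t} {zero}  z≤n   _    = refl
sum<-vanishing-tail f {t} {suc n} t≤1+n vanish with m≤n⇒m<n∨m≡n t≤1+n
... | inj₁ t<1+n = trans (cong₂ _+_ (sum<-vanishing-tail f (s≤s⁻¹ t<1+n) (λ i t≤i i<n → vanish i t≤i (m≤n⇒m≤1+n i<n)))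
                                    (vanish n (s≤s⁻¹ t<1+n) ≤-refl))
                         (+-identityʳ _)
... | inj₂ refl  = refl

sum<-suc : ∀ f n → sum< f (suc n) ≡ f 0 + sum< (λ i → f (suc i)) n
sum<-suc f zero    = +-comm 0 (f 0)
sum<-suc f (suc n) = trans (cong (_+ f (suc n)) (sum<-suc f n)) (+-assoc (f 0) _ _)

sum<-∸-count< : ∀ f P n → (∀ i → i < n → P i ≡ true → 0 < f i) →
  sum< (λ i → f i ∸ b2n (P i)) n + count< P n ≡ sum< f n
sum<-∸-count< f P n 0<f = trans (sym (sum<-+ _ _ n)) (sum<-cong n ∸b2n+b2n)
  where
  ∸b2n+b2n : ∀ i → i < n → (f i ∸ b2n (P i)) + b2n (P i) ≡ f i
  ∸b2n+b2n i i<n with P i in Pi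
  ... | true  = m∸n+n≡m (0<f i i<n Pi)
  ... | false = +-identityʳ (f i)

∸-∸-comm : ∀ a b c → (a ∸ b) ∸ c ≡ (a ∸ c) ∸ b
∸-∸-comm a b c = trans (∸-+-assoc a b c) (trans (cong (a ∸_) (+-comm b c)) (sym (∸-+-assoc a c b)))

b2n≤1 : ∀ b → b2n b ≤ 1
b2n≤1 true  = ≤-refl
b2n≤1 false = z≤n

count<≤ : ∀ P n → count< P n ≤ n
count<≤ P zero    = z≤n
count<≤ P (suc n) = ≤-trans (+-mono-≤ (count<≤ P n) (b2n≤1 (P n))) (≤-reflexive (+-comm n 1))

count<-<ᵇ : ∀ b n → count< (_<ᵇ b) n ≡ n ⊓ b
count<-<ᵇ b zero    = refl
count<-<ᵇ b (suc n) with n <? b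
... | yes n<b rewrite <⇒<ᵇ≡true n<b =
  trans (cong (_+ 1) (trans (count<-<ᵇ b n) (m≤n⇒m⊓n≡m (<⇒≤ n<b))))
        (trans (+-comm n 1) (sym (m≤n⇒m⊓n≡m n<b)))
... | no n≮b rewrite ≥⇒<ᵇ≡false (≮⇒≥ n≮b) =
  trans (+-identityʳ _) (trans (count<-<ᵇ b n)
        (trans (m≥n⇒m⊓n≡n (≮⇒≥ n≮b)) (sym (m≥n⇒m⊓n≡n (m≤n⇒m≤1+n (≮⇒≥ n≮b))))))

count<-prefix : ∀ {b} n → b ≤ n → count< (_<ᵇ b) n ≡ b
count<-prefix {b} n b≤n = trans (count<-<ᵇ b n) (m≥n⇒m⊓n≡n b≤n)

blocks : ℕ → ℕ → ℕ → ℕ → Bool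
blocks x y z n = (n <ᵇ x) ∨ ((y ≤ᵇ n) ∧ (n <ᵇ z))

blocks-reflects : ∀ x y z n → Reflects (n < x ⊎ (y ≤ n × n < z)) (blocks x y z n)
blocks-reflects x y z n = <ᵇ-reflects-< n x ⊎-reflects (≤ᵇ-reflects-≤ y n ×-reflects <ᵇ-reflects-< n z)

module _ (x y z n : ℕ) where

  blocks-true : n < x ⊎ (y ≤ n × n < z) → blocks x y z n ≡ true
  blocks-true = reflects⇒≡true (blocks-reflects x y z n)

  blocks-false : ¬ (n < x ⊎ (y ≤ n × n < z)) → blocks x y z n ≡ false
  blocks-false = reflects⇒≡false (blocks-reflects x y z n)

  blocks-true⁻ : blocks x y z n ≡ true → n < x ⊎ (y ≤ n × n < z)
  blocks-true⁻ = ≡true⇒reflected (blocks-reflects x y z n)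

  blocks-merge : x ≤ z → blocks x x z n ≡ (n <ᵇ z)
  blocks-merge x≤z with n <? x
  ... | yes n<x rewrite <⇒<ᵇ≡true n<x = sym (<⇒<ᵇ≡true (<-≤-trans n<x x≤z))
  ... | no  n≮x rewrite ≥⇒<ᵇ≡false (≮⇒≥ n≮x) | ≤⇒≤ᵇ≡true (≮⇒≥ n≮x) = refl

  blocks-emptyʳ : blocks x y y n ≡ (n <ᵇ x)
  blocks-emptyʳ = blocks-false-right (≤ᵇ-reflects-≤ y n) (<ᵇ-reflects-< n y)
    where
    blocks-false-right : ∀ {b c} → Reflects (y ≤ n) b → Reflects (n < y) c → (n <ᵇ x) ∨ (b ∧ c) ≡ (n <ᵇ x)
    blocks-false-right (ofʸ y≤n) (ofʸ n<y) = ⊥-elim (<⇒≱ n<y y≤n)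
    blocks-false-right (ofʸ _)   (ofⁿ _)   = ∨-identityʳ _
    blocks-false-right (ofⁿ _)   _         = ∨-identityʳ _

  blocks-middle : ¬ n < x → n < z → blocks x y z n ≡ (y ≤ᵇ n)
  blocks-middle n≮x n<z = trans (cong₂ (λ a b → a ∨ ((y ≤ᵇ n) ∧ b)) (≥⇒<ᵇ≡false (≮⇒≥ n≮x)) (<⇒<ᵇ≡true n<z))
                                (∧-identityʳ (y ≤ᵇ n))

  blocks-beyond : x ≤ y → y ≤ z → z ≤ n → blocks x y z n ≡ false
  blocks-beyond x≤y y≤z n≥z = blocks-false
    [ (λ n<x → <⇒≱ (<-≤-trans n<x (≤-trans x≤y y≤z)) n≥z) , (λ (_ , n<z) → <⇒≱ n<z n≥z) ]

  b2n-blocks : x ≤ y → b2n (blocks x y z n) ≡ b2n (n <ᵇ x) + b2n ((y ≤ᵇ n) ∧ (n <ᵇ z))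
  b2n-blocks x≤y with n <? x
  ... | yes n<x rewrite <⇒<ᵇ≡true n<x | >⇒≤ᵇ≡false (<-≤-trans n<x x≤y) = refl
  ... | no  n≮x rewrite ≥⇒<ᵇ≡false (≮⇒≥ n≮x) = refl

count<-blocks : ∀ {x y z r} → x ≤ y → y ≤ z → z ≤ r → count< (blocks x y z) r ≡ x + (z ∸ y)
count<-blocks {x} {y} {z} {r} x≤y y≤z z≤r = begin
  count< (blocks x y z) r                     ≡⟨ sum<-cong r (λ i _ → b2n-blocks x y z i x≤y) ⟩
  sum< (λ i → b2n (i <ᵇ x) + b2n (block i)) r ≡⟨ sum<-+ _ _ r ⟩
  count< (_<ᵇ x) r + count< block r           ≡⟨ cong₂ _+_ (count<-prefix r (≤-trans x≤y (≤-trans y≤z z≤r))) count<-block ⟩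
  x + (z ∸ y)                                 ∎
  where
  open ≡-Reasoning
  block : ℕ → Bool
  block i = (y ≤ᵇ i) ∧ (i <ᵇ z)
  prefix+block : y + count< block r ≡ z
  prefix+block = begin
    y + count< block r                          ≡⟨ cong (_+ count< block r) (count<-prefix r (≤-trans y≤z z≤r)) ⟨
    count< (_<ᵇ y) r + count< block r           ≡⟨ sum<-+ _ _ r ⟨
    sum< (λ i → b2n (i <ᵇ y) + b2n (block i)) r ≡⟨ sum<-cong r (λ i _ → trans (sym (b2n-blocks y y z i ≤-refl))
                                                                             (cong b2n (blocks-merge y y z i y≤z))) ⟩
    count< (_<ᵇ z) r                            ≡⟨ count<-prefix r z≤r ⟩
    z                                           ∎
  count<-block : count< block r ≡ z ∸ y
  count<-block = trans (sym (m+n∸m≡n y _)) (cong (_∸ y) prefix+block)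

-- Δ g is the column of A* computed from the column g of A
Δ : ∀ {r} → (ℕ → ℕ) → Fin r → ℤ
Δ g i = (ℤ.+ g (toℕ i)) ℤ.- (ℤ.+ g (suc (toℕ i)))

jump : Bool → Bool → ℤ
jump a b = (ℤ.+ b2n a) ℤ.- (ℤ.+ b2n b)

jump-diag : ∀ b → jump b b ≡ ℤ.+ 0
jump-diag true  = refl
jump-diag false = refl

<ᵇ-step : ∀ {n x} → suc n ≢ x → (n <ᵇ x) ≡ (suc n <ᵇ x)
<ᵇ-step {n} {x} 1+n≢x with <-cmp (suc n) x
... | tri< 1+n<x _ _ = trans (<⇒<ᵇ≡true (<⇒≤ 1+n<x)) (sym (<⇒<ᵇ≡true 1+n<x))
... | tri≈ _ 1+n≡x _ = ⊥-elim (1+n≢x 1+n≡x)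
... | tri> _ _ x<1+n = trans (≥⇒<ᵇ≡false (s≤s⁻¹ x<1+n)) (sym (≥⇒<ᵇ≡false (<⇒≤ x<1+n)))

≤ᵇ-step : ∀ {y n} → y ≢ suc n → (y ≤ᵇ n) ≡ (y ≤ᵇ suc n)
≤ᵇ-step {y} {n} y≢1+n with <-cmp y (suc n)
... | tri< y<1+n _ _ = trans (≤⇒≤ᵇ≡true (s≤s⁻¹ y<1+n)) (sym (≤⇒≤ᵇ≡true (<⇒≤ y<1+n)))
... | tri≈ _ y≡1+n _ = ⊥-elim (y≢1+n y≡1+n)
... | tri> _ _ 1+n<y = trans (>⇒≤ᵇ≡false (<-trans (n<1+n n) 1+n<y)) (sym (>⇒≤ᵇ≡false 1+n<y))

blocks-step : ∀ {x y z n} → suc n ≢ x → suc n ≢ y → suc n ≢ z → blocks x y z n ≡ blocks x y z (suc n)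
blocks-step ≢x ≢y ≢z = cong₂ _∨_ (<ᵇ-step ≢x) (cong₂ _∧_ (≤ᵇ-step (≢y ∘ sym)) (<ᵇ-step ≢z))

suc-toℕ-≢ : ∀ {r p} (p<r : p < r) (k : Fin r) → k ≢ fromℕ< p<r → suc (toℕ k) ≢ suc p
suc-toℕ-≢ p<r k k≢ e = k≢ (toℕ-injective (trans (suc-injective e) (sym (toℕ-fromℕ< p<r))))

module BlockColumn (r : ℕ) (g : ℕ → ℕ) (x y z : ℕ) (g≡ : ∀ n → n ≤ r → g n ≡ b2n (blocks x y z n)) where

  private
    B : ℕ → Bool
    B = blocks x y z

  Δ-jump : ∀ (i : Fin r) {p} → toℕ i ≡ p → Δ g i ≡ jump (B p) (B (suc p))
  Δ-jump i refl = cong₂ (λ a b → (ℤ.+ a) ℤ.- (ℤ.+ b)) (g≡ _ (<⇒≤ (toℕ<n i))) (g≡ _ (toℕ<n i))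

  Δ≡+1 : ∀ (i : Fin r) {p} → toℕ i ≡ p → B p ≡ true → B (suc p) ≡ false → Δ g i ≡ ℤ.+ 1
  Δ≡+1 i i≡p Bp B1+p = trans (Δ-jump i i≡p) (cong₂ jump Bp B1+p)

  Δ≡-1 : ∀ (i : Fin r) {p} → toℕ i ≡ p → B p ≡ false → B (suc p) ≡ true → Δ g i ≡ -1ℤ
  Δ≡-1 i i≡p Bp B1+p = trans (Δ-jump i i≡p) (cong₂ jump Bp B1+p)

  Δ≡0 : ∀ (k : Fin r) → suc (toℕ k) ≢ x → suc (toℕ k) ≢ y → suc (toℕ k) ≢ z → Δ g k ≡ ℤ.+ 0
  Δ≡0 k ≢x ≢y ≢z = trans (Δ-jump k refl)
    (trans (cong (jump (B (toℕ k))) (sym (blocks-step ≢x ≢y ≢z))) (jump-diag (B (toℕ k))))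

module _ {r : ℕ} {g : ℕ → ℕ} where

  -- for x ≡ y ≡ 0 the indicator blocks x y w is definitionally (_<ᵇ w)
  prefix-Type1 : ∀ {w} → 0 < w → w ≤ r → (∀ n → n ≤ r → g n ≡ b2n (n <ᵇ w)) → Type1 (Δ {r} g)
  prefix-Type1 {suc p} _ p<r g≡ =
    a , Δ≡+1 a (toℕ-fromℕ< p<r) (blocks-true 0 0 (suc p) p (inj₂ (z≤n , ≤-refl)))
                                 (blocks-false 0 0 (suc p) (suc p) [ (λ ()) , (λ (_ , p<p) → <-irrefl refl p<p) ])
      , λ k k≢a → Δ≡0 k (λ ()) (λ ()) (suc-toℕ-≢ p<r k k≢a)
    where
    open BlockColumn r g 0 0 (suc p) g≡
    a = fromℕ< p<r

  block-Type2 : ∀ {p q} → p < q → q < r → (∀ n → n ≤ r → g n ≡ b2n (blocks 0 (suc p) (suc q) n)) → Type2 (Δ {r} g)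
  block-Type2 {p} {q} p<q q<r g≡ =
    a , b , subst₂ _<_ (sym (toℕ-fromℕ< p<r)) (sym (toℕ-fromℕ< q<r)) p<q
      , Δ≡-1 a (toℕ-fromℕ< p<r) (blocks-false 0 (suc p) (suc q) p [ (λ ()) , (λ (1+p≤p , _) → <-irrefl refl 1+p≤p) ])
                                (blocks-true 0 (suc p) (suc q) (suc p) (inj₂ (≤-refl , s≤s p<q)))
      , Δ≡+1 b (toℕ-fromℕ< q<r) (blocks-true 0 (suc p) (suc q) q (inj₂ (p<q , ≤-refl)))
                                (blocks-false 0 (suc p) (suc q) (suc q) [ (λ ()) , (λ (_ , q<q) → <-irrefl refl q<q) ])
      , λ k k≢a k≢b → Δ≡0 k (λ ()) (suc-toℕ-≢ p<r k k≢a) (suc-toℕ-≢ q<r k k≢b)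
    where
    open BlockColumn r g 0 (suc p) (suc q) g≡
    p<r = <-trans p<q q<r
    a = fromℕ< p<r
    b = fromℕ< q<r

  blocks-Type3 : ∀ {o p q} → o < p → p < q → q < r → (∀ n → n ≤ r → g n ≡ b2n (blocks (suc o) (suc p) (suc q) n)) →
    Type3 (Δ {r} g)
  blocks-Type3 {o} {p} {q} o<p p<q q<r g≡ =
    b , a , d , subst₂ _<_ (sym (toℕ-fromℕ< o<r)) (sym (toℕ-fromℕ< p<r)) o<p
      , subst₂ _<_ (sym (toℕ-fromℕ< p<r)) (sym (toℕ-fromℕ< q<r)) p<q
      , Δ≡-1 a (toℕ-fromℕ< p<r) (blocks-false (suc o) (suc p) (suc q) p
                                   [ (λ p≤o → <⇒≱ o<p (s≤s⁻¹ p≤o)) , (λ (1+p≤p , _) → <-irrefl refl 1+p≤p) ])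
                                (blocks-true (suc o) (suc p) (suc q) (suc p) (inj₂ (≤-refl , s≤s p<q)))
      , Δ≡+1 b (toℕ-fromℕ< o<r) (blocks-true (suc o) (suc p) (suc q) o (inj₁ ≤-refl))
                                (blocks-false (suc o) (suc p) (suc q) (suc o)
                                   [ (λ o<o → <-irrefl refl o<o) , (λ (p≤o , _) → <⇒≱ o<p (s≤s⁻¹ p≤o)) ])
      , Δ≡+1 d (toℕ-fromℕ< q<r) (blocks-true (suc o) (suc p) (suc q) q (inj₂ (p<q , ≤-refl)))
                                (blocks-false (suc o) (suc p) (suc q) (suc q)
                                   [ (λ 1+q<1+o → <-asym (<-trans o<p p<q) (s≤s⁻¹ 1+q<1+o)) , (λ (_ , q<q) → <-irrefl refl q<q) ])
      , λ k k≢a k≢b k≢d → Δ≡0 k (suc-toℕ-≢ o<r k k≢b) (suc-toℕ-≢ p<r k k≢a) (suc-toℕ-≢ q<r k k≢d)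
    where
    open BlockColumn r g (suc o) (suc p) (suc q) g≡
    p<r = <-trans p<q q<r
    o<r = <-trans o<p p<r
    a = fromℕ< p<r
    b = fromℕ< o<r
    d = fromℕ< q<r

  blocks-Δ-Type1 : ∀ {x y z} → x ≡ y → y ≤ z → z ≤ r → 0 < x + (z ∸ y) →
    (∀ n → n ≤ r → g n ≡ b2n (blocks x y z n)) → Type1 (Δ {r} g)
  blocks-Δ-Type1 {x} {_} {z} refl x≤z z≤r 0<size g≡ =
    prefix-Type1 (subst (0 <_) (m+[n∸m]≡n x≤z) 0<size) z≤r
                 (λ n n≤r → trans (g≡ n n≤r) (cong b2n (blocks-merge x x z n x≤z)))

  blocks-Δ-type : ∀ {x y z} → x ≤ y → y ≤ z → z ≤ r → 0 < x + (z ∸ y) →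
    (∀ n → n ≤ r → g n ≡ b2n (blocks x y z n)) → Type1 (Δ {r} g) ⊎ Type2 (Δ {r} g) ⊎ Type3 (Δ {r} g)
  blocks-Δ-type {x} {y} {z} x≤y y≤z z≤r 0<size g≡ with x ≟ y | y ≟ z
  ... | yes x≡y  | _        = inj₁ (blocks-Δ-Type1 x≡y y≤z z≤r 0<size g≡)
  ... | no _     | yes refl =
    inj₁ (prefix-Type1 (subst (0 <_) (trans (cong (λ u → x + u) (n∸n≡0 y)) (+-identityʳ x)) 0<size) (≤-trans x≤y z≤r)
                       (λ n n≤r → trans (g≡ n n≤r) (cong b2n (blocks-emptyʳ x y y n))))
  ... | no x≢y   | no y≢z   = separated-Δ-type (≤∧≢⇒< x≤y x≢y) (≤∧≢⇒< y≤z y≢z) z≤r g≡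
    where
    separated-Δ-type : ∀ {x y z} → x < y → y < z → z ≤ r → (∀ n → n ≤ r → g n ≡ b2n (blocks x y z n)) →
      Type1 (Δ {r} g) ⊎ Type2 (Δ {r} g) ⊎ Type3 (Δ {r} g)
    separated-Δ-type {zero}  (s≤s _)   (s≤s p<q) q<r g≡ = inj₂ (inj₁ (block-Type2 p<q q<r g≡))
    separated-Δ-type {suc _} (s≤s o<p) (s≤s p<q) q<r g≡ = inj₂ (inj₂ (blocks-Type3 o<p p<q q<r g≡))

at-beyond : ∀ {r} (v : Vec ℕ r) {i} → r ≤ i → at v i ≡ 0
at-beyond []      _         = refl
at-beyond (x ∷ v) {suc i} r≤i = at-beyond v (s≤s⁻¹ r≤i)

at-toℕ : ∀ {r} (v : Vec ℕ r) (i : Fin r) → at v (toℕ i) ≡ lookup v i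
at-toℕ (x ∷ v) Fin.zero    = refl
at-toℕ (x ∷ v) (Fin.suc i) = at-toℕ v i

at-antitone : ∀ {r} (v : Vec ℕ r) → IsPartition v → ∀ {i j} → i ≤ j → at v j ≤ at v i
at-antitone {r} v part {i} {j} i≤j with j <? r
... | no  j≮r = subst (_≤ at v i) (sym (at-beyond v (≮⇒≥ j≮r))) z≤n
... | yes j<r = subst₂ _≤_ (trans (sym (at-toℕ v fj)) (cong (at v) (toℕ-fromℕ< j<r)))
                           (trans (sym (at-toℕ v fi)) (cong (at v) (toℕ-fromℕ< i<r)))
                           (part fi fj (subst₂ _≤_ (sym (toℕ-fromℕ< i<r)) (sym (toℕ-fromℕ< j<r)) i≤j))
  where
  i<r = ≤-<-trans i≤j j<r
  fi = fromℕ< i<r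
  fj = fromℕ< j<r

psum≡sum< : ∀ {r} (v : Vec ℕ r) t → psum v t ≡ sum< (at v) t
psum≡sum< v zero    = refl
psum≡sum< v (suc t) = cong (_+ at v t) (psum≡sum< v t)

conj≡count< : ∀ {r} (v : Vec ℕ r) j → conj v j ≡ count< (λ i → j ≤ᵇ at v i) r
conj≡count< []      j = refl
conj≡count< {suc r} (x ∷ v) j =
  trans (cong₂ _+_ (if-b2n (j ≤ᵇ x)) (conj≡count< v j)) (sym (sum<-suc (λ i → b2n (j ≤ᵇ at (x ∷ v) i)) r))
  where
  if-b2n : ∀ b → (if b then 1 else 0) ≡ b2n b
  if-b2n true  = refl
  if-b2n false = refl

-- Diagrams with r rows and their conjugates

module _ (P : ℕ → Bool) (downClosed : ∀ {m n} → m ≤ n → P n ≡ true → P m ≡ true) where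

  false-upClosed : ∀ {m n} → m ≤ n → P m ≡ false → P n ≡ false
  false-upClosed {m} {n} m≤n Pm with P n in Pn
  ... | false = refl
  ... | true  = case trans (sym Pm) (downClosed m≤n Pn) of λ ()

  downClosed-prefix : ∀ r → P r ≡ false → ∃[ a ] (∀ n → P n ≡ (n <ᵇ a))
  downClosed-prefix zero    P0 = 0 , λ n → false-upClosed z≤n P0
  downClosed-prefix (suc r) P1+r with P r in Pr
  ... | false = downClosed-prefix r Pr
  ... | true  = suc r , P≡
    where
    P≡ : ∀ n → P n ≡ (n <ᵇ suc r)
    P≡ n with n <? suc r
    ... | yes n<1+r = trans (downClosed (s≤s⁻¹ n<1+r) Pr) (sym (<⇒<ᵇ≡true n<1+r))
    ... | no  n≮1+r = trans (false-upClosed (≮⇒≥ n≮1+r) P1+r) (sym (≥⇒<ᵇ≡false (≮⇒≥ n≮1+r)))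

truncate : (ℕ → ℕ) → ℕ → ℕ → ℕ
truncate h k i = h i ⊓ k

∸≡∸suc+b2n : ∀ x m → x ∸ m ≡ (x ∸ suc m) + b2n (suc m ≤ᵇ x)
∸≡∸suc+b2n zero    m       = 0∸n≡0 m
∸≡∸suc+b2n (suc x) zero    = +-comm 1 x
∸≡∸suc+b2n (suc x) (suc m) = ∸≡∸suc+b2n x m

b2n-≤ᵇ-antitone : ∀ {m m′} x → m ≤ m′ → b2n (m′ ≤ᵇ x) ≤ b2n (m ≤ᵇ x)
b2n-≤ᵇ-antitone {m} {m′} x m≤m′ with m′ ≤? x
... | yes m′≤x rewrite ≤⇒≤ᵇ≡true m′≤x | ≤⇒≤ᵇ≡true (≤-trans m≤m′ m′≤x) = ≤-refl
... | no  m′≰x rewrite >⇒≤ᵇ≡false (≰⇒> m′≰x) = z≤n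

≤ᵇ-⊓ : ∀ {m k} x → m ≤ k → (m ≤ᵇ x ⊓ k) ≡ (m ≤ᵇ x)
≤ᵇ-⊓ {m} {k} x m≤k with m ≤? x
... | yes m≤x = trans (≤⇒≤ᵇ≡true (⊓-glb m≤x m≤k)) (sym (≤⇒≤ᵇ≡true m≤x))
... | no  m≰x = trans (>⇒≤ᵇ≡false (≤-<-trans (m⊓n≤m x k) (≰⇒> m≰x))) (sym (>⇒≤ᵇ≡false (≰⇒> m≰x)))

⊓-suc-∸ : ∀ x {k m} → m ≤ k → (x ⊓ suc k) ∸ m ≡ ((x ⊓ k) ∸ m) + b2n (suc k ≤ᵇ x)
⊓-suc-∸ x {k} {m} m≤k with suc k ≤? x
... | yes 1+k≤x rewrite m≥n⇒m⊓n≡n 1+k≤x | m≥n⇒m⊓n≡n (≤-trans (n≤1+n k) 1+k≤x) | ≤⇒≤ᵇ≡true 1+k≤x =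
  trans (+-∸-assoc 1 m≤k) (+-comm 1 (k ∸ m))
... | no  1+k≰x rewrite m≤n⇒m⊓n≡m (s≤s⁻¹ (≰⇒> 1+k≰x)) | m≤n⇒m⊓n≡m (m≤n⇒m≤1+n (s≤s⁻¹ (≰⇒> 1+k≰x)))
                      | >⇒≤ᵇ≡false (≰⇒> 1+k≰x) = sym (+-identityʳ _)

⊓-suc-∸-suc : ∀ x k m → (x ⊓ suc k) ∸ suc m ≤ (x ⊓ k) ∸ m
⊓-suc-∸-suc zero    k m = z≤n
⊓-suc-∸-suc (suc x) k m = ∸-monoˡ-≤ m (⊓-monoˡ-≤ k (n≤1+n x))

module Rows (r : ℕ) where

  conjugate : (ℕ → ℕ) → ℕ → ℕ
  conjugate h m = count< (λ i → m ≤ᵇ h i) r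

  cellsBeyond : (ℕ → ℕ) → ℕ → ℕ
  cellsBeyond h m = sum< (λ i → h i ∸ m) r

  preferred : (ℕ → ℕ) → ℕ → ℕ → Bool
  preferred h i n = (h i <ᵇ h n) ∨ ((h i ≡ᵇ h n) ∧ (i <ᵇ n))

  conjugate≤r : ∀ h m → conjugate h m ≤ r
  conjugate≤r h m = count<≤ _ r

  cellsBeyond≡cellsBeyond[1+]+conjugate : ∀ h m → cellsBeyond h m ≡ cellsBeyond h (suc m) + conjugate h (suc m)
  cellsBeyond≡cellsBeyond[1+]+conjugate h m = trans (sum<-cong r (λ i _ → ∸≡∸suc+b2n (h i) m)) (sum<-+ _ _ r)

  cellsBeyond-vanishing : ∀ h {m} → (∀ i → i < r → h i ≤ m) → cellsBeyond h m ≡ 0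
  cellsBeyond-vanishing h h≤m = sum<-zero _ r (λ i i<r → m≤n⇒m∸n≡0 (h≤m i i<r))

  cellsBeyond≡conjugate : ∀ h {m} → (∀ i → i < r → h i ≤ suc m) → cellsBeyond h m ≡ conjugate h (suc m)
  cellsBeyond≡conjugate h {m} h≤1+m =
    trans (cellsBeyond≡cellsBeyond[1+]+conjugate h m) (cong (_+ conjugate h (suc m)) (cellsBeyond-vanishing h h≤1+m))

  conjugate-antitone : ∀ h {m m′} → m ≤ m′ → conjugate h m′ ≤ conjugate h m
  conjugate-antitone h m≤m′ = sum<-mono-≤ r (λ i _ → b2n-≤ᵇ-antitone (h i) m≤m′)

  conjugate-truncate : ∀ h {m k} → m ≤ k → conjugate (truncate h k) m ≡ conjugate h m
  conjugate-truncate h m≤k = sum<-cong r (λ i _ → cong b2n (≤ᵇ-⊓ (h i) m≤k))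

  cellsBeyond-truncate-suc : ∀ h {k m} → m ≤ k →
    cellsBeyond (truncate h (suc k)) m ≡ cellsBeyond (truncate h k) m + conjugate h (suc k)
  cellsBeyond-truncate-suc h m≤k = trans (sum<-cong r (λ i _ → ⊓-suc-∸ (h i) m≤k)) (sum<-+ _ _ r)

  cellsBeyond-truncate-suc-suc : ∀ h k m → cellsBeyond (truncate h (suc k)) (suc m) ≤ cellsBeyond (truncate h k) m
  cellsBeyond-truncate-suc-suc h k m = sum<-mono-≤ r (λ i _ → ⊓-suc-∸-suc (h i) k m)

  conjugate-dominance : ∀ {g h} m → cellsBeyond h m ≡ cellsBeyond g m → cellsBeyond h (suc m) ≤ cellsBeyond g (suc m) →
    conjugate g (suc m) ≤ conjugate h (suc m)
  conjugate-dominance {g} {h} m eq le = +-cancelˡ-≤ (cellsBeyond g (suc m)) _ _ (begin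
    cellsBeyond g (suc m) + conjugate g (suc m) ≡⟨ cellsBeyond≡cellsBeyond[1+]+conjugate g m ⟨
    cellsBeyond g m                             ≡⟨ eq ⟨
    cellsBeyond h m                             ≡⟨ cellsBeyond≡cellsBeyond[1+]+conjugate h m ⟩
    cellsBeyond h (suc m) + conjugate h (suc m) ≤⟨ +-monoˡ-≤ _ le ⟩
    cellsBeyond g (suc m) + conjugate h (suc m) ∎)
    where open ≤-Reasoning

  module Antitone {h : ℕ → ℕ} (antitone : ∀ {i j} → i ≤ j → h j ≤ h i) where

    conjugate-prefix : ∀ m {n} → n < r → (m ≤ᵇ h n) ≡ (n <ᵇ conjugate h m)
    conjugate-prefix m {n} n<r = begin
      m ≤ᵇ h n           ≡⟨ cong (_∧ (m ≤ᵇ h n)) (<⇒<ᵇ≡true n<r) ⟨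
      P n                ≡⟨ P≡ n ⟩
      n <ᵇ a             ≡⟨ cong (n <ᵇ_) a≡conjugate ⟩
      n <ᵇ conjugate h m ∎
      where
      open ≡-Reasoning
      P : ℕ → Bool
      P n = (n <ᵇ r) ∧ (m ≤ᵇ h n)
      P-downClosed : ∀ {i j} → i ≤ j → P j ≡ true → P i ≡ true
      P-downClosed {i} {j} i≤j Pj with j <? r
      ... | yes j<r rewrite <⇒<ᵇ≡true j<r | <⇒<ᵇ≡true (≤-<-trans i≤j j<r) =
        ≤⇒≤ᵇ≡true (≤-trans (≤ᵇ≡true⇒≤ {m} Pj) (antitone i≤j))
      ... | no  j≮r rewrite ≥⇒<ᵇ≡false (≮⇒≥ j≮r) = case Pj of λ ()
      prefix = downClosed-prefix P P-downClosed r (cong (_∧ (m ≤ᵇ h r)) (≥⇒<ᵇ≡false {r} ≤-refl))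
      a = proj₁ prefix
      P≡ = proj₂ prefix
      a≤r : a ≤ r
      a≤r = <ᵇ≡false⇒≥ (trans (sym (P≡ r)) (cong (_∧ (m ≤ᵇ h r)) (≥⇒<ᵇ≡false {r} ≤-refl)))
      a≡conjugate : a ≡ conjugate h m
      a≡conjugate = begin
        a                ≡⟨ count<-prefix r a≤r ⟨
        count< (_<ᵇ a) r ≡⟨ sum<-cong r (λ i i<r → cong b2n (trans (sym (P≡ i))
                                                                     (cong (_∧ (m ≤ᵇ h i)) (<⇒<ᵇ≡true i<r)))) ⟩
        conjugate h m    ∎

    ≤⇒<conjugate : ∀ {m n} → n < r → m ≤ h n → n < conjugate h m
    ≤⇒<conjugate {m} n<r m≤hn = <ᵇ≡true⇒< (trans (sym (conjugate-prefix m n<r)) (≤⇒≤ᵇ≡true m≤hn))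

    <conjugate⇒≤ : ∀ {m n} → n < conjugate h m → m ≤ h n
    <conjugate⇒≤ {m} n<c = ≤ᵇ≡true⇒≤ (trans (conjugate-prefix m (<-≤-trans n<c (conjugate≤r h m))) (<⇒<ᵇ≡true n<c))

    ≥conjugate⇒> : ∀ {m n} → n < r → conjugate h m ≤ n → h n < m
    ≥conjugate⇒> {m} n<r c≤n = ≤ᵇ≡false⇒> (trans (conjugate-prefix m n<r) (≥⇒<ᵇ≡false c≤n))

    conjugate[1+h]≤ : ∀ {i} → i < r → conjugate h (suc (h i)) ≤ i
    conjugate[1+h]≤ i<r = ≮⇒≥ (λ i<α → <-irrefl refl (<conjugate⇒≤ i<α))

    count<-preferred : ∀ {i} → i < r →
      count< (preferred h i) r ≡ conjugate h (suc (h i)) + (conjugate h (h i) ∸ suc i)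
    count<-preferred {i} i<r =
      trans (sum<-cong r (λ n n<r → cong b2n (preferred≡blocks n<r))) (count<-blocks α≤1+i 1+i≤β (conjugate≤r h (h i)))
      where
      α = conjugate h (suc (h i))
      β = conjugate h (h i)
      α≤1+i : α ≤ suc i
      α≤1+i = ≤-trans (conjugate[1+h]≤ i<r) (n≤1+n i)
      1+i≤β : suc i ≤ β
      1+i≤β = ≤⇒<conjugate i<r ≤-refl
      tie : ∀ {n} → n < r → h i ≡ h n → (i <ᵇ n) ≡ blocks α (suc i) β n
      tie {n} n<r hi≡hn with i <? n
      ... | yes i<n = trans (<⇒<ᵇ≡true i<n)
                            (sym (blocks-true α (suc i) β n (inj₂ (i<n , ≤⇒<conjugate n<r (≤-reflexive hi≡hn)))))
      ... | no  i≮n = trans (≥⇒<ᵇ≡false (≮⇒≥ i≮n))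
                            (sym (blocks-false α (suc i) β n
                               [ (λ n<α → <-irrefl refl (subst (suc (h i) ≤_) (sym hi≡hn) (<conjugate⇒≤ n<α))) ,
                                 (λ (i<n , _) → i≮n i<n) ]))
      preferred≡blocks : ∀ {n} → n < r → preferred h i n ≡ blocks α (suc i) β n
      preferred≡blocks {n} n<r with <-cmp (h i) (h n)
      ... | tri< hi<hn _ _ = trans (cong (_∨ ((h i ≡ᵇ h n) ∧ (i <ᵇ n))) (<⇒<ᵇ≡true hi<hn))
                                   (sym (blocks-true α (suc i) β n (inj₁ (≤⇒<conjugate n<r hi<hn))))
      ... | tri≈ _ hi≡hn _ = trans (cong₂ (λ a b → a ∨ (b ∧ (i <ᵇ n))) (≥⇒<ᵇ≡false (≤-reflexive (sym hi≡hn))) (≡⇒≡ᵇ≡true hi≡hn))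
                                   (tie n<r hi≡hn)
      ... | tri> _ hi≢hn hn<hi = trans (cong₂ (λ a b → a ∨ (b ∧ (i <ᵇ n))) (≥⇒<ᵇ≡false (<⇒≤ hn<hi)) (≢⇒≡ᵇ≡false hi≢hn))
                                   (sym (blocks-false α (suc i) β n
                                      [ (λ n<α → <⇒≱ hn<hi (≤-trans (n≤1+n (h i)) (<conjugate⇒≤ n<α))) ,
                                        (λ (_ , n<β) → <⇒≱ hn<hi (<conjugate⇒≤ n<β)) ]))

LeftJustified : (ℕ → Bool) → ℕ → ℕ → Set
LeftJustified f ℓ k = ∀ c → c < k → f c ≡ (c <ᵇ ℓ)

countRow≡count< : ∀ f n → countRow f n ≡ count< f n
countRow≡count< f zero    = refl
countRow≡count< f (suc n) = cong (_+ b2n (f n)) (countRow≡count< f n)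

rank≡count< : ∀ M j n i → rank M j n i ≡ count< (λ m → prefers M j m i) n
rank≡count< M j zero    i = refl
rank≡count< M j (suc n) i = cong (_+ b2n (prefers M j n i)) (rank≡count< M j n i)

countRow-leftJustified : ∀ f {ℓ k} → ℓ ≤ k → LeftJustified f ℓ k → countRow f k ≡ ℓ
countRow-leftJustified f {ℓ} {k} ℓ≤k lj =
  trans (countRow≡count< f k) (trans (sum<-cong k (λ c c<k → cong b2n (lj c c<k))) (count<-prefix k ℓ≤k))

rightmost-leftJustified : ∀ f {p k} → suc p ≤ k → LeftJustified f (suc p) k → rightmost f k ≡ just p
rightmost-leftJustified f {p} {suc n} 1+p≤1+n lj with n <? suc p
... | yes n<1+p rewrite lj n ≤-refl | <⇒<ᵇ≡true n<1+p = cong just (≤-antisym (s≤s⁻¹ n<1+p) (s≤s⁻¹ 1+p≤1+n))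
... | no  n≮1+p rewrite lj n ≤-refl | ≥⇒<ᵇ≡false (≮⇒≥ n≮1+p) =
  rightmost-leftJustified f (≮⇒≥ n≮1+p) (λ c c<n → lj c (m≤n⇒m≤1+n c<n))

rightmost-< : ∀ f {n p} → rightmost f n ≡ just p → p < n
rightmost-< f {suc n} eq with f n
... | true  = ≤-reflexive (cong suc (sym (just-injective eq)))
... | false = m≤n⇒m≤1+n (rightmost-< f eq)

moveRow-beyond : ∀ f {k c} → k < c → moveRow f k c ≡ f c
moveRow-beyond f {k} {c} k<c with rightmost f (suc k) in eq
... | nothing = refl
... | just p rewrite ≢⇒≡ᵇ≡false {c} {k} (λ c≡k → <-irrefl (sym c≡k) k<c)
                   | ≢⇒≡ᵇ≡false {c} {p} (λ c≡p → <-irrefl (sym c≡p) (<-≤-trans (rightmost-< f eq) k<c)) = refl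

module _ (f : ℕ → Bool) {p k : ℕ} (p≤k : p ≤ k) (lj : LeftJustified f (suc p) (suc k)) where

  moveRow-target : moveRow f k k ≡ true
  moveRow-target with rightmost f (suc k) | rightmost-leftJustified f (s≤s p≤k) lj
  ... | just .p | refl rewrite ≡⇒≡ᵇ≡true {k} refl = refl

  moveRow-leftJustified : LeftJustified (moveRow f k) p k
  moveRow-leftJustified c c<k with rightmost f (suc k) | rightmost-leftJustified f (s≤s p≤k) lj
  ... | just .p | refl rewrite ≢⇒≡ᵇ≡false {c} {k} (<⇒≢ c<k) with c ≟ p
  ...   | yes refl rewrite ≡⇒≡ᵇ≡true {c} refl = sym (≥⇒<ᵇ≡false {c} ≤-refl)
  ...   | no  c≢p  rewrite ≢⇒≡ᵇ≡false c≢p = trans (lj c (m≤n⇒m≤1+n c<k)) (<ᵇ-suc c≢p)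
    where
    <ᵇ-suc : ∀ {c p} → c ≢ p → (c <ᵇ suc p) ≡ (c <ᵇ p)
    <ᵇ-suc {c} {p} c≢p with c <? p
    ... | yes c<p = trans (<⇒<ᵇ≡true (m≤n⇒m≤1+n c<p)) (sym (<⇒<ᵇ≡true c<p))
    ... | no  c≮p = trans (≥⇒<ᵇ≡false (≤∧≢⇒< (≮⇒≥ c≮p) (c≢p ∘ sym))) (sym (≥⇒<ᵇ≡false (≮⇒≥ c≮p)))

step-beyond : ∀ r cnt M {k} i {c} → k < c → step r cnt M k i c ≡ M i c
step-beyond r cnt M {k} i k<c with chosen r M (suc k) cnt i
... | false = refl
... | true  = moveRow-beyond (M i) k<c

run-beyond : ∀ {r} (lam : Vec ℕ r) k M i {c} → k ≤ c → run lam k M i c ≡ M i c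
run-beyond     lam zero    M i _   = refl
run-beyond {r} lam (suc k) M i k<c =
  trans (run-beyond lam k _ i (≤-trans (n≤1+n k) k<c)) (step-beyond r (conj lam (suc k)) M i k<c)

-- Ryser's algorithm

module Ryser (r : ℕ) (lam : Vec ℕ r) where

  open Rows r

  -- the state when the columns < k (0-based) are still to be filled
  record Invariant (k : ℕ) (M : BMat) (h : ℕ → ℕ) : Set where
    field
      justified : ∀ i → LeftJustified (M i) (h i) k
      bounded   : ∀ i → h i ≤ k
      antitone  : ∀ {i j} → i ≤ j → h j ≤ h i
      vanishing : ∀ {i} → r ≤ i → h i ≡ 0
      dominated : ∀ m → cellsBeyond h m ≤ cellsBeyond (truncate (at lam) k) m
      balanced  : cellsBeyond h 0 ≡ cellsBeyond (truncate (at lam) k) 0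

  record TwoBlockColumn (col : ℕ → Bool) (c : ℕ) : Set where
    field
      x y z      : ℕ
      x≤y        : x ≤ y
      y≤z        : y ≤ z
      z≤r        : z ≤ r
      nonempty   : 0 < x + (z ∸ y)
      col≡blocks : ∀ i → col i ≡ blocks x y z i
      leftmost   : c ≡ 0 → x ≡ y

  module Step {k : ℕ} {M : BMat} {h : ℕ → ℕ} (inv : Invariant (suc k) M h) (k<λ₁ : k < at lam 0) where

    open Invariant inv
    open Antitone antitone

    K : ℕ
    K = conj lam (suc k)

    K≡conjugate : K ≡ conjugate (at lam) (suc k)
    K≡conjugate = conj≡count< lam (suc k)

    0<K : 0 < K
    0<K = subst (0 <_) (sym K≡conjugate)
      (≤-trans (≤-reflexive (cong b2n (sym (≤⇒≤ᵇ≡true k<λ₁)))) (sum<-monoʳ-≤ _ 0<r))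
      where
      0<r : 0 < r
      0<r = ≰⇒> (λ r≤0 → <⇒≱ k<λ₁ (≤-trans (≤-reflexive (at-beyond lam r≤0)) z≤n))

    K≤r : K ≤ r
    K≤r = subst (_≤ r) (sym K≡conjugate) (conjugate≤r (at lam) (suc k))

    K≤conjugate-h-1 : K ≤ conjugate h 1
    K≤conjugate-h-1 = begin
      K                                             ≡⟨ K≡conjugate ⟩
      conjugate (at lam) (suc k)                    ≡⟨ conjugate-truncate (at lam) ≤-refl ⟨
      conjugate (truncate (at lam) (suc k)) (suc k) ≤⟨ conjugate-antitone (truncate (at lam) (suc k)) (s≤s z≤n) ⟩
      conjugate (truncate (at lam) (suc k)) 1       ≤⟨ conjugate-dominance 0 balanced (dominated 1) ⟩
      conjugate h 1                                 ∎
      where open ≤-Reasoning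

    full≤K : conjugate h (suc k) ≤ K
    full≤K = begin
      conjugate h (suc k)                           ≡⟨ cellsBeyond≡conjugate h (λ i _ → bounded i) ⟨
      cellsBeyond h k                               ≤⟨ dominated k ⟩
      cellsBeyond (truncate (at lam) (suc k)) k     ≡⟨ cellsBeyond≡conjugate (truncate (at lam) (suc k)) (λ i _ → m⊓n≤n _ _) ⟩
      conjugate (truncate (at lam) (suc k)) (suc k) ≡⟨ conjugate-truncate (at lam) ≤-refl ⟩
      conjugate (at lam) (suc k)                    ≡⟨ K≡conjugate ⟨
      K                                             ∎
      where open ≤-Reasoning

    v : ℕ
    v = h (K ∸ 1)

    K∸1<K : K ∸ 1 < K
    K∸1<K = ≤-reflexive (m+[n∸m]≡n 0<K)

    K∸1<r : K ∸ 1 < r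
    K∸1<r = <-≤-trans K∸1<K K≤r

    0<v : 0 < v
    0<v = <conjugate⇒≤ (<-≤-trans K∸1<K K≤conjugate-h-1)

    -- the chosen rows: all rows longer than v = h (K ∸ 1), and the southernmost K ∸ α rows of length v
    α β y : ℕ
    α = conjugate h (suc v)
    β = conjugate h v
    y = β ∸ (K ∸ α)

    α<K : α < K
    α<K = ≤-<-trans (conjugate[1+h]≤ K∸1<r) K∸1<K

    K≤β : K ≤ β
    K≤β = subst (_≤ β) (m+[n∸m]≡n 0<K) (≤⇒<conjugate K∸1<r ≤-refl)

    α≤y : α ≤ y
    α≤y = m+n≤o⇒m≤o∸n α (subst (_≤ β) (sym (m+[n∸m]≡n (<⇒≤ α<K))) K≤β)

    y≤β : y ≤ β
    y≤β = m∸n≤m β (K ∸ α)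

    blocks-size : α + (β ∸ y) ≡ K
    blocks-size = trans (cong (α +_) (m∸[m∸n]≡n (≤-trans (m∸n≤m K α) K≤β))) (m+[n∸m]≡n (<⇒≤ α<K))

    prefers≡preferred : ∀ n i → prefers M (suc k) n i ≡ preferred h i n
    prefers≡preferred n i = cong₂ (λ a b → (a <ᵇ b) ∨ ((a ≡ᵇ b) ∧ (i <ᵇ n))) (length i) (length n)
      where
      length : ∀ i → countRow (M i) (suc k) ≡ h i
      length i = countRow-leftJustified (M i) (bounded i) (justified i)

    rank≡ : ∀ {i} → i < r → rank M (suc k) r i ≡ conjugate h (suc (h i)) + (conjugate h (h i) ∸ suc i)
    rank≡ {i} i<r = trans (rank≡count< M (suc k) r i)
                          (trans (sum<-cong r (λ n _ → cong b2n (prefers≡preferred n i))) (count<-preferred i<r))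

    rank<K≡blocks : ∀ {i} → i < r → (conjugate h (suc (h i)) + (conjugate h (h i) ∸ suc i) <ᵇ K) ≡ blocks α y β i
    rank<K≡blocks {i} i<r with <-cmp v (h i)
    ... | tri< v<hi _ _ = trans (<⇒<ᵇ≡true rank<K) (sym (blocks-true α y β i (inj₁ i<α)))
      where
      i<α = ≤⇒<conjugate i<r v<hi
      rank<K : conjugate h (suc (h i)) + (conjugate h (h i) ∸ suc i) < K
      rank<K = begin-strict
        conjugate h (suc (h i)) + (conjugate h (h i) ∸ suc i) ≤⟨ +-mono-≤ (conjugate[1+h]≤ i<r)
                                                                   (∸-monoˡ-≤ (suc i) (conjugate-antitone h v<hi)) ⟩
        i + (α ∸ suc i)                                       <⟨ ≤-reflexive (m+[n∸m]≡n i<α) ⟩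
        α                                                     <⟨ α<K ⟩
        K                                                     ∎
        where open ≤-Reasoning
    ... | tri> _ _ hi<v = trans (≥⇒<ᵇ≡false K≤rank)
                                (sym (blocks-false α y β i [ (λ i<α → i≮β (<-≤-trans i<α (≤-trans α≤y y≤β))) ,
                                                             (λ (_ , i<β) → i≮β i<β) ]))
      where
      i≮β : ¬ i < β
      i≮β i<β = <⇒≱ hi<v (<conjugate⇒≤ i<β)
      K≤rank : K ≤ conjugate h (suc (h i)) + (conjugate h (h i) ∸ suc i)
      K≤rank = ≤-trans K≤β (≤-trans (conjugate-antitone h hi<v) (m≤m+n _ _))
    ... | tri≈ _ v≡hi _ rewrite sym v≡hi = begin
      α + (β ∸ suc i) <ᵇ K           ≡⟨ cong (α + (β ∸ suc i) <ᵇ_) (m+[n∸m]≡n (<⇒≤ α<K)) ⟨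
      α + (β ∸ suc i) <ᵇ α + (K ∸ α) ≡⟨ +-<ᵇ-cancelˡ α ⟩
      β ∸ suc i <ᵇ K ∸ α             ≡⟨ ∸-suc-<ᵇ {d = K ∸ α} i<β ⟩
      y ≤ᵇ i                         ≡⟨ blocks-middle α y β i (λ i<α → <-irrefl v≡hi (<conjugate⇒≤ i<α)) i<β ⟨
      blocks α y β i                 ∎
      where
      open ≡-Reasoning
      i<β = ≤⇒<conjugate i<r (≤-reflexive v≡hi)

    C : ℕ → Bool
    C = chosen r M (suc k) K

    chosen≡blocks : ∀ i → C i ≡ blocks α y β i
    chosen≡blocks i with i <? r
    ... | yes i<r = trans (cong (_∧ (rank M (suc k) r i <ᵇ K)) (<⇒<ᵇ≡true i<r))
                          (trans (cong (_<ᵇ K) (rank≡ i<r)) (rank<K≡blocks i<r))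
    ... | no  i≮r = trans (cong (_∧ (rank M (suc k) r i <ᵇ K)) (≥⇒<ᵇ≡false (≮⇒≥ i≮r)))
                          (sym (blocks-false α y β i [ i≮r ∘ i<β⇒i<r ∘ (λ i<α → <-≤-trans i<α (≤-trans α≤y y≤β)) ,
                                                       (λ (_ , i<β) → i≮r (i<β⇒i<r i<β)) ]))
      where
      i<β⇒i<r : i < β → i < r
      i<β⇒i<r i<β = <-≤-trans i<β (conjugate≤r h v)

    chosen⇒v≤ : ∀ {i} → C i ≡ true → v ≤ h i
    chosen⇒v≤ {i} Ci = [ (λ i<α → <⇒≤ (<conjugate⇒≤ i<α)) , (λ (_ , i<β) → <conjugate⇒≤ i<β) ]
                         (blocks-true⁻ α y β i (trans (sym (chosen≡blocks i)) Ci))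

    chosen⇒0<h : ∀ {i} → C i ≡ true → 0 < h i
    chosen⇒0<h Ci = <-≤-trans 0<v (chosen⇒v≤ Ci)

    longer⇒chosen : ∀ {i} → i < r → v < h i → C i ≡ true
    longer⇒chosen {i} i<r v<hi = trans (chosen≡blocks i) (blocks-true α y β i (inj₁ (≤⇒<conjugate i<r v<hi)))

    α≡0 : v ≡ suc k → α ≡ 0
    α≡0 v≡1+k = n≤0⇒n≡0 (≮⇒≥ (λ 0<α → <⇒≱ (<conjugate⇒≤ 0<α) (subst (h 0 ≤_) (sym v≡1+k) (bounded 0))))

    y≡0 : v ≡ suc k → y ≡ 0
    y≡0 v≡1+k = m≤n⇒m∸n≡0 (subst (λ a → β ≤ K ∸ a) (sym (α≡0 v≡1+k))
                                 (subst (λ u → conjugate h u ≤ K) (sym v≡1+k) full≤K))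

    full⇒chosen : ∀ {i} → h i ≡ suc k → C i ≡ true
    full⇒chosen {i} hi≡1+k with i <? r | m≤n⇒m<n∨m≡n (bounded (K ∸ 1))
    ... | no  i≮r | _         = case trans (sym (vanishing (≮⇒≥ i≮r))) hi≡1+k of λ ()
    ... | yes i<r | inj₁ v<1+k = longer⇒chosen i<r (subst (v <_) (sym hi≡1+k) v<1+k)
    ... | yes i<r | inj₂ v≡1+k =
      trans (chosen≡blocks i) (blocks-true α y β i (inj₂ (subst (_≤ i) (sym (y≡0 v≡1+k)) z≤n ,
                                                          ≤⇒<conjugate i<r (≤-reflexive (trans v≡1+k (sym hi≡1+k))))))

    unchosen⇒≤k : ∀ {i} → C i ≡ false → h i ≤ k
    unchosen⇒≤k {i} Ci with m≤n⇒m<n∨m≡n (bounded i)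
    ... | inj₁ hi<1+k = s≤s⁻¹ hi<1+k
    ... | inj₂ hi≡1+k = case trans (sym Ci) (full⇒chosen hi≡1+k) of λ ()

    h′ : ℕ → ℕ
    h′ i = h i ∸ b2n (C i)

    h∸1≤k : ∀ i → h i ∸ 1 ≤ k
    h∸1≤k i = ∸-monoˡ-≤ 1 (bounded i)

    justified-chosen : ∀ {i} → C i ≡ true → LeftJustified (M i) (suc (h i ∸ 1)) (suc k)
    justified-chosen {i} Ci = subst (λ ℓ → LeftJustified (M i) ℓ (suc k)) (sym (m+[n∸m]≡n (chosen⇒0<h Ci))) (justified i)

    column-k : ∀ i → step r K M k i k ≡ C i
    column-k i with chosen r M (suc k) K i in Ci
    ... | true  = moveRow-target (M i) (h∸1≤k i) (justified-chosen Ci)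
    ... | false = trans (justified i k ≤-refl) (≥⇒<ᵇ≡false (unchosen⇒≤k Ci))

    justified′ : ∀ i → LeftJustified (step r K M k i) (h′ i) k
    justified′ i c c<k with chosen r M (suc k) K i in Ci
    ... | true  = moveRow-leftJustified (M i) (h∸1≤k i) (justified-chosen Ci) c c<k
    ... | false = justified i c (m≤n⇒m≤1+n c<k)

    bounded′ : ∀ i → h′ i ≤ k
    bounded′ i with chosen r M (suc k) K i in Ci
    ... | true  = h∸1≤k i
    ... | false = unchosen⇒≤k Ci

    antitone′ : ∀ {i j} → i ≤ j → h′ j ≤ h′ i
    antitone′ {i} {j} i≤j with chosen r M (suc k) K i in Ci | chosen r M (suc k) K j in Cj
    ... | false | b     = ≤-trans (m∸n≤m (h j) (b2n b)) (antitone i≤j)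
    ... | true  | true  = ∸-monoˡ-≤ 1 (antitone i≤j)
    ... | true  | false with m≤n⇒m<n∨m≡n (antitone i≤j)
    ...   | inj₁ hj<hi = ≤-trans (≤-reflexive (sym (m+n∸m≡n 1 (h j)))) (∸-monoˡ-≤ 1 hj<hi)
    ...   | inj₂ hj≡hi = case trans (sym Cj) (chosen-like-i hj≡hi) of λ ()
      where
      j<r : j < r
      j<r = ≰⇒> (λ r≤j → <⇒≢ (chosen⇒0<h Ci) (sym (trans (sym hj≡hi) (vanishing r≤j))))
      chosen-like-i : h j ≡ h i → C j ≡ true
      chosen-like-i hj≡hi = trans (chosen≡blocks j) (blocks-true α y β j
        ([ (λ i<α → inj₁ (≤⇒<conjugate j<r (subst (suc v ≤_) (sym hj≡hi) (<conjugate⇒≤ i<α)))) ,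
           (λ (y≤i , i<β) → inj₂ (≤-trans y≤i i≤j , ≤⇒<conjugate j<r (subst (v ≤_) (sym hj≡hi) (<conjugate⇒≤ i<β)))) ]
         (blocks-true⁻ α y β i (trans (sym (chosen≡blocks i)) Ci))))

    vanishing′ : ∀ {i} → r ≤ i → h′ i ≡ 0
    vanishing′ {i} r≤i = trans (cong (_∸ b2n (C i)) (vanishing r≤i)) (0∸n≡0 (b2n (C i)))

    count-chosen : count< C r ≡ K
    count-chosen = trans (sum<-cong r (λ i _ → cong b2n (chosen≡blocks i)))
                         (trans (count<-blocks α≤y y≤β (conjugate≤r h v)) blocks-size)

    -- each of the K chosen rows loses one cell, and all of them reach beyond column m
    cellsBeyond-shortened : ∀ {m} → m < v → cellsBeyond h′ m + K ≡ cellsBeyond h m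
    cellsBeyond-shortened {m} m<v = begin
      cellsBeyond h′ m + K                              ≡⟨ cong₂ _+_ (sum<-cong r (λ i _ → ∸-∸-comm (h i) (b2n (C i)) m))
                                                                      (sym count-chosen) ⟩
      sum< (λ i → (h i ∸ m) ∸ b2n (C i)) r + count< C r ≡⟨ sum<-∸-count< (λ i → h i ∸ m) C r
                                                             (λ i _ Ci → m<n⇒0<n∸m (<-≤-trans m<v (chosen⇒v≤ Ci))) ⟩
      cellsBeyond h m                                   ∎
      where open ≡-Reasoning

    dominated′ : ∀ m → cellsBeyond h′ m ≤ cellsBeyond (truncate (at lam) k) m
    dominated′ m with v ≤? m
    ... | no  v≰m = +-cancelʳ-≤ K _ _ (begin
      cellsBeyond h′ m + K                                             ≡⟨ cellsBeyond-shortened (≰⇒> v≰m) ⟩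
      cellsBeyond h m                                                  ≤⟨ dominated m ⟩
      cellsBeyond (truncate (at lam) (suc k)) m                        ≡⟨ cellsBeyond-truncate-suc (at lam) m≤k ⟩
      cellsBeyond (truncate (at lam) k) m + conjugate (at lam) (suc k) ≡⟨ cong (cellsBeyond (truncate (at lam) k) m +_) K≡conjugate ⟨
      cellsBeyond (truncate (at lam) k) m + K                          ∎)
      where
      open ≤-Reasoning
      m≤k = s≤s⁻¹ (<-≤-trans (≰⇒> v≰m) (bounded (K ∸ 1)))
    ... | yes v≤m = begin
      cellsBeyond h′ m                                ≤⟨ sum<-mono-≤ r shortened≤ ⟩
      cellsBeyond h (suc m)                           ≤⟨ dominated (suc m) ⟩
      cellsBeyond (truncate (at lam) (suc k)) (suc m) ≤⟨ cellsBeyond-truncate-suc-suc (at lam) k m ⟩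
      cellsBeyond (truncate (at lam) k) m             ∎
      where
      open ≤-Reasoning
      shortened≤ : ∀ i → i < r → h′ i ∸ m ≤ h i ∸ suc m
      shortened≤ i i<r with h i ≤? m
      ... | yes hi≤m = ≤-trans (∸-monoˡ-≤ m (m∸n≤m (h i) (b2n (C i))))
                               (≤-reflexive (trans (m≤n⇒m∸n≡0 hi≤m) (sym (m≤n⇒m∸n≡0 (m≤n⇒m≤1+n hi≤m)))))
      ... | no  hi≰m = ≤-reflexive (trans (cong (λ b → (h i ∸ b2n b) ∸ m) (longer⇒chosen i<r (≤-<-trans v≤m (≰⇒> hi≰m))))
                                          (∸-+-assoc (h i) 1 m))

    balanced′ : cellsBeyond h′ 0 ≡ cellsBeyond (truncate (at lam) k) 0
    balanced′ = +-cancelʳ-≡ K _ _ (begin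
      cellsBeyond h′ 0 + K                                             ≡⟨ cellsBeyond-shortened 0<v ⟩
      cellsBeyond h 0                                                  ≡⟨ balanced ⟩
      cellsBeyond (truncate (at lam) (suc k)) 0                        ≡⟨ cellsBeyond-truncate-suc (at lam) z≤n ⟩
      cellsBeyond (truncate (at lam) k) 0 + conjugate (at lam) (suc k) ≡⟨ cong (cellsBeyond (truncate (at lam) k) 0 +_) K≡conjugate ⟨
      cellsBeyond (truncate (at lam) k) 0 + K                          ∎)
      where open ≡-Reasoning

    invariant′ : Invariant k (step r K M k) h′
    invariant′ = record
      { justified = justified′ ; bounded = bounded′ ; antitone = antitone′ ; vanishing = vanishing′
      ; dominated = dominated′ ; balanced = balanced′ }

    column-shape : TwoBlockColumn (λ i → step r K M k i k) k
    column-shape = record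
      { x = α ; y = y ; z = β ; x≤y = α≤y ; y≤z = y≤β ; z≤r = conjugate≤r h v
      ; nonempty = subst (0 <_) (sym blocks-size) 0<K
      ; col≡blocks = λ i → trans (column-k i) (chosen≡blocks i)
      ; leftmost = λ k≡0 → trans (α≡0 (v≡1 k≡0)) (sym (y≡0 (v≡1 k≡0)))
      }
      where
      -- in the last column every row is empty or full
      v≡1 : k ≡ 0 → v ≡ suc k
      v≡1 refl = ≤-antisym (bounded (K ∸ 1)) 0<v

  TwoBlockColumn-cong : ∀ {col col′ c} → (∀ i → col i ≡ col′ i) → TwoBlockColumn col′ c → TwoBlockColumn col c
  TwoBlockColumn-cong col≡col′ shape = record
    { x = x ; y = y ; z = z ; x≤y = x≤y ; y≤z = y≤z ; z≤r = z≤r ; nonempty = nonempty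
    ; col≡blocks = λ i → trans (col≡col′ i) (col≡blocks i) ; leftmost = leftmost }
    where open TwoBlockColumn shape

  columns : ∀ k M h → Invariant k M h → k ≤ at lam 0 → ∀ c → c < k → TwoBlockColumn (λ i → run lam k M i c) c
  columns (suc k) M h inv 1+k≤λ₁ c c<1+k with m≤n⇒m<n∨m≡n (s≤s⁻¹ c<1+k)
  ... | inj₁ c<k  = columns k _ h′ invariant′ (<⇒≤ 1+k≤λ₁) c c<k
    where open Step inv 1+k≤λ₁
  ... | inj₂ refl = TwoBlockColumn-cong (λ i → run-beyond lam c _ i ≤-refl) column-shape
    where open Step inv 1+k≤λ₁

cellsBeyond-dominance : ∀ {r} {lam mu : Vec ℕ r} → IsPartition mu → (∀ t → t ≤ r → psum mu t ≤ psum lam t) →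
  ∀ m → Rows.cellsBeyond r (at mu) m ≤ Rows.cellsBeyond r (at lam) m
cellsBeyond-dominance {r} {lam} {mu} mu-part dominance m = +-cancelʳ-≤ (t * m) _ _ (begin
  cellsBeyond (at mu) m + t * m                  ≡⟨ cong (_+ t * m) (sum<-vanishing-tail _ t≤r short-vanish) ⟩
  sum< (λ i → at mu i ∸ m) t + t * m             ≡⟨ cong (sum< (λ i → at mu i ∸ m) t +_) (sum<-const m t) ⟨
  sum< (λ i → at mu i ∸ m) t + sum< (λ _ → m) t  ≡⟨ sum<-+ _ _ t ⟨
  sum< (λ i → (at mu i ∸ m) + m) t               ≡⟨ sum<-cong t (λ i i<t → m∸n+n≡m (<⇒≤ (<conjugate⇒≤ i<t))) ⟩
  sum< (at mu) t                                 ≡⟨ psum≡sum< mu t ⟨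
  psum mu t                                      ≤⟨ dominance t t≤r ⟩
  psum lam t                                     ≡⟨ psum≡sum< lam t ⟩
  sum< (at lam) t                                ≤⟨ sum<-mono-≤ t (λ i _ → ≤-trans (m≤n+m∸n (at lam i) m)
                                                                            (≤-reflexive (+-comm m _))) ⟩
  sum< (λ i → (at lam i ∸ m) + m) t              ≡⟨ sum<-+ _ _ t ⟩
  sum< (λ i → at lam i ∸ m) t + sum< (λ _ → m) t ≡⟨ cong (sum< (λ i → at lam i ∸ m) t +_) (sum<-const m t) ⟩
  sum< (λ i → at lam i ∸ m) t + t * m            ≤⟨ +-monoˡ-≤ (t * m) (sum<-monoʳ-≤ _ t≤r) ⟩
  cellsBeyond (at lam) m + t * m                 ∎)
  where
  open Rows r
  open Antitone (at-antitone mu mu-part)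
  open ≤-Reasoning
  t = conjugate (at mu) (suc m)
  t≤r = conjugate≤r (at mu) (suc m)
  short-vanish : ∀ i → t ≤ i → i < r → at mu i ∸ m ≡ 0
  short-vanish i t≤i i<r = m≤n⇒m∸n≡0 (s≤s⁻¹ (≥conjugate⇒> i<r t≤i))

initial-invariant : ∀ {r} {lam mu : Vec ℕ r} → Kostka r lam mu → Ryser.Invariant r lam (at lam 0) (initMat mu) (at mu)
initial-invariant {r} {lam} {mu} (lam-part , mu-part , sizes , dominance) = record
  { justified = λ i c _ → refl
  ; bounded   = λ i → ≤-trans (at-antitone mu mu-part z≤n) μ₁≤λ₁
  ; antitone  = at-antitone mu mu-part
  ; vanishing = at-beyond mu
  ; dominated = λ m → subst (cellsBeyond (at mu) m ≤_) (cellsBeyond-untruncated m) (cellsBeyond-dominance mu-part dominance m)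
  ; balanced  = trans (sym (psum≡sum< mu r)) (trans (sym sizes) (trans (psum≡sum< lam r) (cellsBeyond-untruncated 0)))
  }
  where
  open Rows r
  cellsBeyond-untruncated : ∀ m → cellsBeyond (at lam) m ≡ cellsBeyond (truncate (at lam) (at lam 0)) m
  cellsBeyond-untruncated m = sum<-cong r (λ i _ → cong (_∸ m) (sym (m≤n⇒m⊓n≡m (at-antitone lam lam-part z≤n))))
  μ₁≤λ₁ : at mu 0 ≤ at lam 0
  μ₁≤λ₁ with 1 ≤? r
  ... | yes 1≤r = dominance 1 1≤r
  ... | no  1≰r = subst (_≤ at lam 0) (sym (at-beyond mu (s≤s⁻¹ (≰⇒> 1≰r)))) z≤n

module _ {r : ℕ} (lam mu : Vec ℕ r) where

  Aℕ-beyond : ∀ {n} c → r ≤ n → Aℕ lam mu n c ≡ 0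
  Aℕ-beyond c r≤n rewrite ≥⇒<ᵇ≡false r≤n = refl

  Aℕ-column : ∀ (j : Fin (firstPart lam)) {col : ℕ → Bool} →
    (∀ i → run lam (firstPart lam) (initMat mu) i (toℕ j) ≡ col i) → (∀ n → r ≤ n → col n ≡ false) →
    ∀ n → n ≤ r → Aℕ lam mu n (toℕ j) ≡ b2n (col n)
  Aℕ-column j run≡col col-beyond n n≤r with m≤n⇒m<n∨m≡n n≤r
  ... | inj₁ n<r rewrite <⇒<ᵇ≡true n<r | <⇒<ᵇ≡true (toℕ<n j) = cong b2n (run≡col n)
  ... | inj₂ refl = trans (Aℕ-beyond (toℕ j) ≤-refl) (cong b2n (sym (col-beyond n ≤-refl)))

lemma2p14 : (r : ℕ) (lam mu : Vec ℕ r) → Kostka r lam mu →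
    (∀ (j : Fin (firstPart lam)) →
        Type1 (λ i → Astar lam mu i j) ⊎ Type2 (λ i → Astar lam mu i j)
          ⊎ Type3 (λ i → Astar lam mu i j))
    × (∀ (j : Fin (firstPart lam)) → toℕ j ≡ 0 → Type1 (λ i → Astar lam mu i j))
    × (∀ (i : Fin r) → toℕ i ≡ r ∸ 1 → ∀ (j : Fin (firstPart lam)) → Astar lam mu i j ≢ -1ℤ)
lemma2p14 r lam mu kostka = all-columns , first-column , bottom-row
  where
  open Ryser r lam using (TwoBlockColumn; columns)
  shape : (j : Fin (firstPart lam)) → TwoBlockColumn (λ i → run lam (firstPart lam) (initMat mu) i (toℕ j)) (toℕ j)
  shape j = columns (firstPart lam) (initMat mu) (at mu) (initial-invariant kostka) ≤-refl (toℕ j) (toℕ<n j)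
  module Shape j = TwoBlockColumn (shape j)
  column≡blocks : ∀ j n → n ≤ r → Aℕ lam mu n (toℕ j) ≡ b2n (blocks (Shape.x j) (Shape.y j) (Shape.z j) n)
  column≡blocks j = Aℕ-column lam mu j col≡blocks (λ n r≤n → blocks-beyond x y z n x≤y y≤z (≤-trans z≤r r≤n))
    where open TwoBlockColumn (shape j)
  all-columns = λ j → let open TwoBlockColumn (shape j) in blocks-Δ-type x≤y y≤z z≤r nonempty (column≡blocks j)
  first-column = λ j j≡0 → let open TwoBlockColumn (shape j) in
    blocks-Δ-Type1 (leftmost j≡0) y≤z z≤r nonempty (column≡blocks j)
  bottom-row : ∀ (i : Fin r) → toℕ i ≡ r ∸ 1 → ∀ (j : Fin (firstPart lam)) → Astar lam mu i j ≢ -1ℤ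
  bottom-row i i≡r∸1 j with Aℕ lam mu (suc (toℕ i)) (toℕ j)
                           | Aℕ-beyond lam mu (toℕ j) (subst (λ t → r ≤ suc t) (sym i≡r∸1) (m≤n+m∸n r 1))
  ... | _ | refl = λ ()
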